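{- Let $T,T'\in\mathcal T_\alpha$. Then $T'$ is an edge expansion of $T$ if and only if $f(T')=(S_{T'},E_{T'})$ is a formal edge expansion of $f(T)=(S_T,E_T)$.
   Context: $\alpha$ is a finite sequence of labels in $\{\mathrm{in},\mathrm{out}\}$. An $\alpha$-tree is a planar (plane-embedded) tree with directed edges and at least one interior (non-leaf) vertex, together with a chosen exterior vertex (leaf), such that: labelling each exterior vertex "in" if its incident edge is directed away from it and "out" if directed toward it, and reading exterior vertices in clockwise order from the chosen one, gives exactly $\alpha$; every interior vertex has at least one outgoing edge; and there is no bivalent vertex with one incoming and one outgoing edge. $\mathcal T_\alpha$ is the set of $\alpha$-trees. An edge is interior if both endpoints are interior vertices. $T'$ is an edge expansion of $T$ if contracting some nonempty set of interior edges of $T'$ yields $T$. A Stasheff tree is a rooted planar tree with no bivalent vertices (a $(\mathrm{out},\mathrm{in},\dots,\mathrm{in})$-tree), and edge expansion of Stasheff trees is defined in the same way. For $T\in\mathcal T_\alpha$: $S_T$ is the Stasheff tree obtained by forgetting orientations and deleting each bivalent vertex (merging its two edges), with the same chosen exterior vertex. $E_T$ (the essential spine of $T$) is obtained from the union, with orientations, of the shortest paths in $T$ between pairs of outgoing exterior vertices, by deleting vertices bivalent in $T$ and merging their two edges into one edge labelled $\leftrightarrow$; other edges are labelled by their orientation in $T$. $f(T)=(S_T,E_T)$; the set of such pairs (Stasheff tree with a compatible essential spine) is $\mathcal{SE}_\alpha$. For $(S,E),(S',E')\in\mathcal{SE}_\alpha$, $(S',E')$ is a formal edge expansion of $(S,E)$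 by one edge if either (i) $S'=S$ and $E'$ is obtained from $E$ by changing the label of one edge from an orientation to $\leftrightarrow$; (ii) $S'$ is a one-edge expansion of $S$, the new edge does not lie in the essential spine, and $E'=E$; or (iii) $S'$ is a one-edge expansion of $S$, the new edge lies in $E'$ and is labelled by an orientation (not $\leftrightarrow$) in $E'$. A formal edge expansion is a finite nonempty sequence of formal edge expansions by one edge. -}

module Defs where

open import Data.Bool using (Bool; true; false; if_then_else_; _∧_)
open import Data.Nat using (ℕ; zero; suc; _+_; _<ᵇ_; _≤_)
open import Data.List using (List; []; _∷_; _++_)
open import Data.List.Relation.Unary.Any using (Any)
open import Data.Product using (Σ; _×_; _,_; proj₁; proj₂; ∃)
open import Data.Sum using (_⊎_)
open import Data.Unit using (⊤)
open import Data.Empty using (⊥)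
open import Relation.Nullary using (¬_)
open import Relation.Binary.PropositionalEquality using (_≡_)
open import Relation.Binary.Construct.Closure.Transitive using (TransClosure)

data Lbl : Set where
  lin lout : Lbl

-- A tree is rooted at the chosen leaf r.  Every other vertex is a
-- 'node' carrying the list of its child edges, listed in clockwise
-- order starting right after its parent edge; each child edge carries
-- its orientation:  up   = directed towards the parent (towards r),
--                   down = directed towards the child (away from r).
-- A non-root vertex is exterior (a leaf) iff it has no children.
-- Isomorphism classes of plane trees with a chosen leaf correspond
-- bijectively to such terms, so tree equality is _≡_.

data Dir : Set where
  up down : Dir

data Node : Set where
  node : List (Dir × Node) → Node

-- A whole tree: the orientation of the edge at the chosen leaf r,
-- and the vertex adjacent to r.
Tree : Set
Tree = Dir × Node

IsInteriorNode : Node → Set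
IsInteriorNode (node [])      = ⊥
IsInteriorNode (node (_ ∷ _)) = ⊤

-- labels of exterior vertices
-- a non-root leaf whose edge points towards the parent: edge directed away → in
leafLbl : Dir → Lbl
leafLbl up   = lin
leafLbl down = lout

-- the root leaf: edge directed away from root (down) → in
rootLbl : Dir → Lbl
rootLbl up   = lout
rootLbl down = lin

leafWordL : List (Dir × Node) → List Lbl
leafWordL [] = []
leafWordL ((d , node []) ∷ cs)       = leafLbl d ∷ leafWordL cs
leafWordL ((d , node (x ∷ xs)) ∷ cs) = leafWordL (x ∷ xs) ++ leafWordL cs

word : Tree → List Lbl
word (d , node cs) = rootLbl d ∷ leafWordL cs

HasOut : Dir → List (Dir × Node) → Set
HasOut d cs = (d ≡ up) ⊎ Any (λ c → proj₁ c ≡ down) cs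

-- not (bivalent with one incoming and one outgoing edge).
-- For a bivalent vertex with parent edge d and child edge d',
-- "one in, one out" happens exactly when d' ≡ d.
NotThrough : Dir → List (Dir × Node) → Set
NotThrough d ((d' , _) ∷ []) = ¬ (d' ≡ d)
NotThrough d _               = ⊤

mutual
  WFNode : Dir → Node → Set
  WFNode d (node [])       = ⊤
  WFNode d (node (c ∷ cs)) = HasOut d (c ∷ cs) × NotThrough d (c ∷ cs) × WFList (c ∷ cs)

  WFList : List (Dir × Node) → Set
  WFList []             = ⊤
  WFList ((d , v) ∷ cs) = WFNode d v × WFList cs

IsAlphaTree : List Lbl → Tree → Set
IsAlphaTree α (d , v) = IsInteriorNode v × word (d , v) ≡ α × WFNode d v

-- Edge expansion: contracting a nonempty set of interior edges.
-- A set of edges of T' is given by a marking of its non-root edges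
-- (the edge at the root leaf is never interior).

data MNode : Set where
  mnode : List (Dir × Bool × MNode) → MNode

MTree : Set
MTree = Dir × MNode

mutual
  eraseN : MNode → Node
  eraseN (mnode cs) = node (eraseL cs)

  eraseL : List (Dir × Bool × MNode) → List (Dir × Node)
  eraseL [] = []
  eraseL ((d , _ , c) ∷ cs) = (d , eraseN c) ∷ eraseL cs

mutual
  contractN : MNode → Node
  contractN (mnode cs) = node (contractL cs)

  contractL : List (Dir × Bool × MNode) → List (Dir × Node)
  contractL [] = []
  contractL ((d , false , c) ∷ cs)       = (d , contractN c) ∷ contractL cs
  contractL ((d , true , mnode ds) ∷ cs) = contractL ds ++ contractL cs

mutual
  -- every marked edge is interior (its lower endpoint is not a leaf;
  -- its upper endpoint is a non-root vertex with children, hence interior)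
  MarkedInteriorN : MNode → Set
  MarkedInteriorN (mnode cs) = MarkedInteriorL cs

  MarkedInteriorL : List (Dir × Bool × MNode) → Set
  MarkedInteriorL [] = ⊤
  MarkedInteriorL ((d , false , c) ∷ cs) = MarkedInteriorN c × MarkedInteriorL cs
  MarkedInteriorL ((d , true , c) ∷ cs)  =
    IsInteriorNode (eraseN c) × MarkedInteriorN c × MarkedInteriorL cs

mutual
  marksN : MNode → ℕ
  marksN (mnode cs) = marksL cs

  marksL : List (Dir × Bool × MNode) → ℕ
  marksL [] = 0
  marksL ((_ , false , c) ∷ cs) = marksN c + marksL cs
  marksL ((_ , true , c) ∷ cs)  = suc (marksN c + marksL cs)

EdgeExpansion : Tree → Tree → Set
EdgeExpansion T' T =
  Σ MTree λ M →
    ((proj₁ M , eraseN (proj₂ M)) ≡ T') ×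
    MarkedInteriorN (proj₂ M) ×
    (1 ≤ marksN (proj₂ M)) ×
    ((proj₁ M , contractN (proj₂ M)) ≡ T)

-- Stasheff trees together with an essential spine, represented as a
-- planar rooted tree (rooted at the chosen leaf, as above) whose edges
-- are labelled: 'none' = not in the essential spine, 'ori d' = in the
-- spine with orientation d, 'both' = in the spine with label ↔.

data Lab : Set where
  none : Lab
  ori  : Dir → Lab
  both : Lab

data LNode : Set where
  lnode : List (Lab × LNode) → LNode

LTree : Set
LTree = Lab × LNode

mutual
  outsE : Dir × Node → ℕ
  outsE (up , node [])        = 0
  outsE (down , node [])      = 1
  outsE (d , node (c ∷ cs))   = outsL (c ∷ cs)

  outsL : List (Dir × Node) → ℕ
  outsL [] = 0
  outsL (c ∷ cs) = outsE c + outsL cs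

rootOut : Dir → ℕ
rootOut up   = 1
rootOut down = 0

totalOuts : Tree → ℕ
totalOuts (d , v) = rootOut d + outsE (d , v)

-- An edge lies on the shortest path between two exterior vertices iff
-- exactly one of them lies below it; hence it lies in the union of the
-- shortest paths between pairs of outgoing exterior vertices iff some
-- outgoing exterior vertex lies below it and some does not.
-- N = total number of outgoing exterior vertices.
inSpine : ℕ → Dir × Node → Bool
inSpine N e = (0 <ᵇ outsE e) ∧ (outsE e <ᵇ N)

isBivalent : Node → Bool
isBivalent (node (_ ∷ [])) = true
isBivalent _               = false

-- label of the (possibly merged) edge starting with the edge (d , c)
labOf : ℕ → Dir → Node → Lab
labOf N d c =
  if inSpine N (d , c)
  then (if isBivalent c then both else ori d)
  else none

mutual
  shapeOf : ℕ → Node → LNode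
  shapeOf N (node ((_ , c) ∷ [])) = shapeOf N c
  shapeOf N (node [])             = lnode []
  shapeOf N (node (x ∷ y ∷ ys))   = lnode (procL N (x ∷ y ∷ ys))

  procL : ℕ → List (Dir × Node) → List (Lab × LNode)
  procL N [] = []
  procL N ((d , c) ∷ cs) = (labOf N d c , shapeOf N c) ∷ procL N cs

f : Tree → LTree
f (d , v) = labOf N d v , shapeOf N v
  where N = totalOuts (d , v)

InSE : List Lbl → LTree → Set
InSE α X = Σ Tree λ T → IsAlphaTree α T × f T ≡ X

mutual
  data RelabelN : LNode → LNode → Set where
    rnode : ∀ {cs ds} → RelabelL cs ds → RelabelN (lnode cs) (lnode ds)

  data RelabelL : List (Lab × LNode) → List (Lab × LNode) → Set where
    rhere : ∀ {d x cs} → RelabelL ((ori d , x) ∷ cs) ((both , x) ∷ cs)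
    rdown : ∀ {l x y cs} → RelabelN x y → RelabelL ((l , x) ∷ cs) ((l , y) ∷ cs)
    rtail : ∀ {c cs ds} → RelabelL cs ds → RelabelL (c ∷ cs) (c ∷ ds)

data Relabel₁ : LTree → LTree → Set where
  rroot  : ∀ {d x} → Relabel₁ (ori d , x) (both , x)
  rinner : ∀ {l x y} → RelabelN x y → Relabel₁ (l , x) (l , y)

-- Contracting one interior edge of X' (labelled l) yields X.
-- Contr₁ X' X l
mutual
  data ContrN : LNode → LNode → Lab → Set where
    cnode : ∀ {cs ds l} → ContrL cs ds l → ContrN (lnode cs) (lnode ds) l

  data ContrL : List (Lab × LNode) → List (Lab × LNode) → Lab → Set where
    chere : ∀ {l e es cs} →
            ContrL ((l , lnode (e ∷ es)) ∷ cs) ((e ∷ es) ++ cs) l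
    cdown : ∀ {k x y cs l} → ContrN x y l →
            ContrL ((k , x) ∷ cs) ((k , y) ∷ cs) l
    ctail : ∀ {c cs ds l} → ContrL cs ds l → ContrL (c ∷ cs) (c ∷ ds) l

-- the edge at the chosen leaf is never interior
Contr₁ : LTree → LTree → Lab → Set
Contr₁ (k , x) (k' , y) l = (k ≡ k') × ContrN x y l

data FormalExp₁ : LTree → LTree → Set where
  relabel : ∀ {X X'} → Relabel₁ X X' → FormalExp₁ X X'
  offSpine : ∀ {X X'} → Contr₁ X' X none → FormalExp₁ X X'
  onSpine : ∀ {X X' d} → Contr₁ X' X (ori d) → FormalExp₁ X X'

FormalExp₁α : List Lbl → LTree → LTree → Set
FormalExp₁α α X X' = InSE α X × InSE α X' × FormalExp₁ X X'

FormalEdgeExpansion : List Lbl → LTree → LTree → Set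
FormalEdgeExpansion α = TransClosure (FormalExp₁α α)

-- Contracting the marked edges one at a time shows that T′ is an edge expansion of T exactly when T
-- arises from T′ by a nonempty chain of single interior-edge contractions, each of which stays in 𝒯_α.
-- Under f a single contraction becomes a formal one-edge expansion: contracting either half of an edge
-- through a bivalent vertex leaves S unchanged and turns the label ↔ into the orientation of the other
-- half (i); any other contraction contracts the corresponding edge of S, which is then not labelled ↔
-- (ii, iii).  Conversely, every formal one-edge expansion f T ⟶ f T′ is realised by contracting an edge
-- of T′, and f is injective on 𝒯_α: a spine edge records its orientation in its label, and any other
-- edge has all outgoing exterior vertices on one side and points towards them.

{-# OPTIONS --safe #-}
module Submission where

open import Defs
open import Data.Bool using (Bool; true; false; if_then_else_; _∧_)
open import Data.Bool.Properties using (T-≡; T-∧)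
open import Data.Nat using (ℕ; zero; suc; _+_; _<ᵇ_; _≤_; z≤n; s≤s)
open import Data.Nat.Properties
  using ( +-assoc; +-suc; +-comm; +-identityʳ; suc-injective; +-cancelˡ-≤; ≤-trans; m≤m+n; m≤n+m
        ; n≤0⇒n≡0; m+n≡0⇒m≡0; m+n≡0⇒n≡0; n≮n; <⇒<ᵇ; <ᵇ⇒<; ≰⇒>; ≮⇒≥)
open import Data.List using (List; []; _∷_; _++_; length)
open import Data.List.Properties using (++-assoc; ++-identityʳ; length-++; ∷-injective; ∷-injectiveˡ; ∷-injectiveʳ)
open import Data.List.Relation.Unary.Any using (Any; here; there)
open import Data.List.Relation.Unary.Any.Properties using (++⁺ˡ; ++⁺ʳ)
open import Data.Product using (Σ; ∃₂; _×_; _,_; proj₁; proj₂)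
open import Data.Product.Properties using (,-injectiveˡ; ,-injectiveʳ)
open import Data.Sum using (_⊎_; inj₁; inj₂)
open import Data.Unit using (⊤; tt)
open import Data.Empty using (⊥; ⊥-elim)
open import Function.Bundles using (_⇔_; mk⇔; Equivalence)
open import Relation.Nullary using (¬_)
open import Relation.Binary.PropositionalEquality
  using (_≡_; _≢_; refl; sym; trans; cong; cong₂; subst; module ≡-Reasoning)
open import Relation.Binary.Construct.Closure.Transitive using (TransClosure; [_]; _∷_; _∷ʳ_)

outCount : List Lbl → ℕ
outCount []          = 0
outCount (lout ∷ ls) = suc (outCount ls)
outCount (lin ∷ ls)  = outCount ls

outCount-++ : ∀ ks ls → outCount (ks ++ ls) ≡ outCount ks + outCount ls
outCount-++ []          ls = refl
outCount-++ (lout ∷ ks) ls = cong suc (outCount-++ ks ls)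
outCount-++ (lin ∷ ks)  ls = outCount-++ ks ls

edgeWord : Dir × Node → List Lbl
edgeWord (d , node [])       = leafLbl d ∷ []
edgeWord (d , node (c ∷ cs)) = leafWordL (c ∷ cs)

leafWordL-∷ : ∀ e cs → leafWordL (e ∷ cs) ≡ edgeWord e ++ leafWordL cs
leafWordL-∷ (d , node [])      cs = refl
leafWordL-∷ (d , node (_ ∷ _)) cs = refl

leafWordL-++ : ∀ cs ds → leafWordL (cs ++ ds) ≡ leafWordL cs ++ leafWordL ds
leafWordL-++ []       ds = refl
leafWordL-++ (e ∷ cs) ds = begin
  leafWordL (e ∷ cs ++ ds)                       ≡⟨ leafWordL-∷ e (cs ++ ds) ⟩
  edgeWord e ++ leafWordL (cs ++ ds)             ≡⟨ cong (edgeWord e ++_) (leafWordL-++ cs ds) ⟩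
  edgeWord e ++ leafWordL cs ++ leafWordL ds     ≡⟨ ++-assoc (edgeWord e) _ _ ⟨
  (edgeWord e ++ leafWordL cs) ++ leafWordL ds   ≡⟨ cong (_++ leafWordL ds) (leafWordL-∷ e cs) ⟨
  leafWordL (e ∷ cs) ++ leafWordL ds             ∎
  where open ≡-Reasoning

edgeWord-bivalent : ∀ d e → edgeWord (d , node (e ∷ [])) ≡ edgeWord e
edgeWord-bivalent d e = trans (leafWordL-∷ e []) (++-identityʳ (edgeWord e))

mutual
  outsE≡outCount-edgeWord : ∀ e → outsE e ≡ outCount (edgeWord e)
  outsE≡outCount-edgeWord (up   , node [])      = refl
  outsE≡outCount-edgeWord (down , node [])      = refl
  outsE≡outCount-edgeWord (up   , node (c ∷ cs)) = outsL≡outCount-leafWordL (c ∷ cs)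
  outsE≡outCount-edgeWord (down , node (c ∷ cs)) = outsL≡outCount-leafWordL (c ∷ cs)

  outsL≡outCount-leafWordL : ∀ cs → outsL cs ≡ outCount (leafWordL cs)
  outsL≡outCount-leafWordL []       = refl
  outsL≡outCount-leafWordL (e ∷ cs) = begin
    outsE e + outsL cs                                ≡⟨ cong₂ _+_ (outsE≡outCount-edgeWord e) (outsL≡outCount-leafWordL cs) ⟩
    outCount (edgeWord e) + outCount (leafWordL cs)   ≡⟨ outCount-++ (edgeWord e) _ ⟨
    outCount (edgeWord e ++ leafWordL cs)             ≡⟨ cong outCount (leafWordL-∷ e cs) ⟨
    outCount (leafWordL (e ∷ cs))                     ∎
    where open ≡-Reasoning

edgeWord≡⇒outsE≡ : ∀ e e′ → edgeWord e ≡ edgeWord e′ → outsE e ≡ outsE e′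
edgeWord≡⇒outsE≡ e e′ eq =
  trans (outsE≡outCount-edgeWord e) (trans (cong outCount eq) (sym (outsE≡outCount-edgeWord e′)))

totalOuts≡outCount : ∀ {α T} → IsAlphaTree α T → totalOuts T ≡ outCount α
totalOuts≡outCount {T = up   , node (c ∷ cs)} (_ , refl , _) = cong suc (outsL≡outCount-leafWordL (c ∷ cs))
totalOuts≡outCount {T = down , node (c ∷ cs)} (_ , refl , _) = outsL≡outCount-leafWordL (c ∷ cs)

-- Single edge contractions

infix 4 _↝ₙ_ _↝ₗ_ _↝_

mutual
  data _↝ₙ_ : Node → Node → Set where
    children : ∀ {cs ds} → cs ↝ₗ ds → node cs ↝ₙ node ds

  data _↝ₗ_ : List (Dir × Node) → List (Dir × Node) → Set where
    at     : ∀ {d e es cs} → (d , node (e ∷ es)) ∷ cs ↝ₗ (e ∷ es) ++ cs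
    under  : ∀ {d x y cs} → x ↝ₙ y → (d , x) ∷ cs ↝ₗ (d , y) ∷ cs
    beside : ∀ {c cs ds} → cs ↝ₗ ds → c ∷ cs ↝ₗ c ∷ ds

data _↝_ : Tree → Tree → Set where
  subtree : ∀ {d v v′} → v ↝ₙ v′ → (d , v) ↝ (d , v′)

mutual
  ↝ₙ-edgeWord : ∀ d {x y} → x ↝ₙ y → edgeWord (d , x) ≡ edgeWord (d , y)
  ↝ₙ-edgeWord d (children o@at)         = ↝ₗ-leafWordL o
  ↝ₙ-edgeWord d (children o@(under _))  = ↝ₗ-leafWordL o
  ↝ₙ-edgeWord d (children o@(beside _)) = ↝ₗ-leafWordL o

  ↝ₗ-leafWordL : ∀ {cs ds} → cs ↝ₗ ds → leafWordL cs ≡ leafWordL ds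
  ↝ₗ-leafWordL (at {e = e} {es} {cs}) = sym (leafWordL-++ (e ∷ es) cs)
  ↝ₗ-leafWordL (under {d} {x} {y} {cs} o) = begin
    leafWordL ((d , x) ∷ cs)             ≡⟨ leafWordL-∷ (d , x) cs ⟩
    edgeWord (d , x) ++ leafWordL cs     ≡⟨ cong (_++ leafWordL cs) (↝ₙ-edgeWord d o) ⟩
    edgeWord (d , y) ++ leafWordL cs     ≡⟨ leafWordL-∷ (d , y) cs ⟨
    leafWordL ((d , y) ∷ cs)             ∎
    where open ≡-Reasoning
  ↝ₗ-leafWordL (beside {c} {cs} {ds} o) = begin
    leafWordL (c ∷ cs)                   ≡⟨ leafWordL-∷ c cs ⟩
    edgeWord c ++ leafWordL cs           ≡⟨ cong (edgeWord c ++_) (↝ₗ-leafWordL o) ⟩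
    edgeWord c ++ leafWordL ds           ≡⟨ leafWordL-∷ c ds ⟨
    leafWordL (c ∷ ds)                   ∎
    where open ≡-Reasoning

↝ₙ-outsE : ∀ d {x y} → x ↝ₙ y → outsE (d , x) ≡ outsE (d , y)
↝ₙ-outsE d {x} {y} o = edgeWord≡⇒outsE≡ (d , x) (d , y) (↝ₙ-edgeWord d o)

↝ₙ-totalOuts : ∀ d {v v′} → v ↝ₙ v′ → totalOuts (d , v′) ≡ totalOuts (d , v)
↝ₙ-totalOuts d o = cong (rootOut d +_) (sym (↝ₙ-outsE d o))

bivalent-orientation : ∀ {d d₁ c₁} → WFNode d (node ((d₁ , c₁) ∷ [])) → d ≡ up × d₁ ≡ down
bivalent-orientation {up}   {up}   (_ , through , _)   = ⊥-elim (through refl)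
bivalent-orientation {up}   {down} _                   = refl , refl
bivalent-orientation {down} {up}   (inj₁ () , _)
bivalent-orientation {down} {up}   (inj₂ (here ()) , _)
bivalent-orientation {down} {down} (_ , through , _)   = ⊥-elim (through refl)

bivalent-child-nonBivalent : ∀ {d d₁ c₁} → WFNode d (node ((d₁ , c₁) ∷ [])) → isBivalent c₁ ≡ false
bivalent-child-nonBivalent {c₁ = node []}          w = refl
bivalent-child-nonBivalent {c₁ = node (_ ∷ _ ∷ _)} w = refl
bivalent-child-nonBivalent {c₁ = node (_ ∷ [])}    w@(_ , _ , w₁ , _) with bivalent-orientation w
... | refl , refl with bivalent-orientation w₁
... | () , _

WFList-++⁺ : ∀ cs ds → WFList cs → WFList ds → WFList (cs ++ ds)
WFList-++⁺ []             ds _          wds = wds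
WFList-++⁺ ((d , v) ∷ cs) ds (wv , wcs) wds = wv , WFList-++⁺ cs ds wcs wds

wfNode : ∀ d cs → HasOut d cs → NotThrough d cs → WFList cs → WFNode d (node cs)
wfNode d []       _ _ _ = tt
wfNode d (_ ∷ _) h n w = h , n , w

↝ₗ-HasOut : ∀ d {cs ds} → WFList cs → HasOut d cs → cs ↝ₗ ds → HasOut d ds
↝ₗ-HasOut d _ (inj₁ d≡up) _ = inj₁ d≡up
↝ₗ-HasOut d ((inj₁ () , _) , _)          (inj₂ (here refl)) at
↝ₗ-HasOut d ((inj₂ downChild , _) , _)   (inj₂ (here refl)) at = inj₂ (++⁺ˡ downChild)
↝ₗ-HasOut d {(_ , node (e ∷ es)) ∷ _} _  (inj₂ (there h))   at = inj₂ (++⁺ʳ (e ∷ es) h)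
↝ₗ-HasOut d _ (inj₂ (here p))  (under _) = inj₂ (here p)
↝ₗ-HasOut d _ (inj₂ (there h)) (under _) = inj₂ (there h)
↝ₗ-HasOut d _ (inj₂ (here p))  (beside _) = inj₂ (here p)
↝ₗ-HasOut d (_ , w) (inj₂ (there h)) (beside o) with ↝ₗ-HasOut d w (inj₂ h) o
... | inj₁ d≡up = inj₁ d≡up
... | inj₂ h′   = inj₂ (there h′)

↝ₗ-NotThrough : ∀ d {cs ds} → WFNode d (node cs) → cs ↝ₗ ds → NotThrough d ds
↝ₗ-NotThrough d {(_ , node (_ ∷ [])) ∷ []} w at with bivalent-child-nonBivalent w
... | ()
↝ₗ-NotThrough d {(_ , node (_ ∷ _ ∷ _)) ∷ _} _ at                    = tt
↝ₗ-NotThrough d {(_ , node (_ ∷ [])) ∷ _ ∷ _}  _ at                    = tt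
↝ₗ-NotThrough d {_ ∷ []}                       (_ , n , _) (under _)   = n
↝ₗ-NotThrough d {_ ∷ _ ∷ _}                    _ (under _)             = tt
↝ₗ-NotThrough d {_ ∷ _ ∷ _}                    _ (beside {ds = _ ∷ _} _) = tt

mutual
  ↝ₙ-WFNode : ∀ d {x y} → WFNode d x → x ↝ₙ y → WFNode d y
  ↝ₙ-WFNode d {node (c ∷ cs)} {node ds} w@(h , _ , ws) (children o) =
    wfNode d ds (↝ₗ-HasOut d ws h o) (↝ₗ-NotThrough d w o) (↝ₗ-WFList ws o)

  ↝ₗ-WFList : ∀ {cs ds} → WFList cs → cs ↝ₗ ds → WFList ds
  ↝ₗ-WFList {(_ , node (e ∷ es)) ∷ cs} ((_ , _ , we) , wcs) at = WFList-++⁺ (e ∷ es) cs we wcs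
  ↝ₗ-WFList {(d , _) ∷ _} (wx , wcs) (under o)  = ↝ₙ-WFNode d wx o , wcs
  ↝ₗ-WFList               (wx , wcs) (beside o) = wx , ↝ₗ-WFList wcs o

↝-IsAlphaTree : ∀ {α T′ T} → IsAlphaTree α T′ → T′ ↝ T → IsAlphaTree α T
↝-IsAlphaTree {T′ = d , node cs} (_ , refl , w) (subtree (children {ds = _ ∷ _} o)) =
  tt , cong (rootLbl d ∷_) (sym (↝ₗ-leafWordL o)) , ↝ₙ-WFNode d w (children o)

-- Edge expansions as chains of single contractions

MList : Set
MList = List (Dir × Bool × MNode)

eraseL-++ : ∀ ms ns → eraseL (ms ++ ns) ≡ eraseL ms ++ eraseL ns
eraseL-++ []             ns = refl
eraseL-++ ((d , _ , c) ∷ ms) ns = cong ((d , eraseN c) ∷_) (eraseL-++ ms ns)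

eraseL-++⁻ : ∀ ms cs ds → eraseL ms ≡ cs ++ ds →
             ∃₂ λ ms₁ ms₂ → ms ≡ ms₁ ++ ms₂ × eraseL ms₁ ≡ cs × eraseL ms₂ ≡ ds
eraseL-++⁻ ms                 []       ds eq = [] , ms , refl , refl , eq
eraseL-++⁻ ((d , b , m) ∷ ms) (c ∷ cs) ds eq with ∷-injective eq
... | refl , eq′ with eraseL-++⁻ ms cs ds eq′
... | ms₁ , ms₂ , refl , refl , refl = (d , b , m) ∷ ms₁ , ms₂ , refl , refl , refl

contractL-++ : ∀ ms ns → contractL (ms ++ ns) ≡ contractL ms ++ contractL ns
contractL-++ []                        ns = refl
contractL-++ ((d , false , c) ∷ ms)     ns = cong ((d , contractN c) ∷_) (contractL-++ ms ns)
contractL-++ ((d , true , mnode ds) ∷ ms) ns = begin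
  contractL ds ++ contractL (ms ++ ns)               ≡⟨ cong (contractL ds ++_) (contractL-++ ms ns) ⟩
  contractL ds ++ contractL ms ++ contractL ns       ≡⟨ ++-assoc (contractL ds) _ _ ⟨
  (contractL ds ++ contractL ms) ++ contractL ns     ∎
  where open ≡-Reasoning

marksL-++ : ∀ ms ns → marksL (ms ++ ns) ≡ marksL ms + marksL ns
marksL-++ []                    ns = refl
marksL-++ ((_ , false , c) ∷ ms) ns =
  trans (cong (marksN c +_) (marksL-++ ms ns)) (sym (+-assoc (marksN c) _ _))
marksL-++ ((_ , true , c) ∷ ms)  ns =
  cong suc (trans (cong (marksN c +_) (marksL-++ ms ns)) (sym (+-assoc (marksN c) _ _)))

MarkedInteriorL-++⁺ : ∀ ms ns → MarkedInteriorL ms → MarkedInteriorL ns → MarkedInteriorL (ms ++ ns)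
MarkedInteriorL-++⁺ []                    ns _             mns = mns
MarkedInteriorL-++⁺ ((_ , false , _) ∷ ms) ns (mc , mms)    mns = mc , MarkedInteriorL-++⁺ ms ns mms mns
MarkedInteriorL-++⁺ ((_ , true , _) ∷ ms)  ns (i , mc , mms) mns = i , mc , MarkedInteriorL-++⁺ ms ns mms mns

MarkedInteriorL-++⁻ : ∀ ms ns → MarkedInteriorL (ms ++ ns) → MarkedInteriorL ms × MarkedInteriorL ns
MarkedInteriorL-++⁻ []                    ns mns = tt , mns
MarkedInteriorL-++⁻ ((_ , false , _) ∷ ms) ns (mc , m) =
  let mms , mns = MarkedInteriorL-++⁻ ms ns m in (mc , mms) , mns
MarkedInteriorL-++⁻ ((_ , true , _) ∷ ms)  ns (i , mc , m) =
  let mms , mns = MarkedInteriorL-++⁻ ms ns m in (i , mc , mms) , mns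

contractL-unmarked : ∀ ms → marksL ms ≡ 0 → contractL ms ≡ eraseL ms
contractL-unmarked []                            _ = refl
contractL-unmarked ((d , false , mnode cs) ∷ ms) e =
  cong₂ (λ a b → (d , node a) ∷ b) (contractL-unmarked cs (m+n≡0⇒m≡0 _ e))
                                   (contractL-unmarked ms (m+n≡0⇒n≡0 (marksL cs) e))

Peeled : MList → Set
Peeled ms = Σ MList λ ms₁ →
  eraseL ms ↝ₗ eraseL ms₁ × contractL ms₁ ≡ contractL ms × suc (marksL ms₁) ≡ marksL ms × MarkedInteriorL ms₁

peel : ∀ ms → MarkedInteriorL ms → 1 ≤ marksL ms → Peeled ms
peel ((d , true , mnode ns@((_ , _ , _) ∷ _)) ∷ ms) (_ , mns , mms) _ =
  ns ++ ms ,
  subst (eraseL ((d , true , mnode ns) ∷ ms) ↝ₗ_) (sym (eraseL-++ ns ms)) at ,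
  contractL-++ ns ms ,
  cong suc (marksL-++ ns ms) ,
  MarkedInteriorL-++⁺ ns ms mns mms
peel ((d , false , mnode cs) ∷ ms) (mc , mms) 1≤marks with marksL cs in eq
... | zero with peel ms mms 1≤marks
...   | ms₁ , o , c≡ , m≡ , mi =
  (d , false , mnode cs) ∷ ms₁ , beside o , cong (_ ∷_) c≡ ,
  trans (cong (λ k → suc (k + marksL ms₁)) eq) m≡ , mc , mi
peel ((d , false , mnode cs) ∷ ms) (mc , mms) _ | suc _ with peel cs mc (subst (1 ≤_) (sym eq) (s≤s z≤n))
...   | cs₁ , o , c≡ , m≡ , mi =
  (d , false , mnode cs₁) ∷ ms , under (children o) , cong (λ z → (d , node z) ∷ contractL ms) c≡ ,
  cong (_+ marksL ms) (trans m≡ eq) , mi , mms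

infix 4 _↝⁺_

_↝⁺_ : Tree → Tree → Set
_↝⁺_ = TransClosure _↝_

marked⇒↝⁺ : ∀ d ms k → marksL ms ≡ suc k → MarkedInteriorL ms →
            (d , node (eraseL ms)) ↝⁺ (d , node (contractL ms))
marked⇒↝⁺ d ms zero eq mi with peel ms mi (subst (1 ≤_) (sym eq) (s≤s z≤n))
... | ms₁ , o , c≡ , m≡ , _ =
  [ subst (λ z → (d , node (eraseL ms)) ↝ (d , node z))
          (trans (sym (contractL-unmarked ms₁ (suc-injective (trans m≡ eq)))) c≡)
          (subtree (children o)) ]
marked⇒↝⁺ d ms (suc k) eq mi with peel ms mi (subst (1 ≤_) (sym eq) (s≤s z≤n))
... | ms₁ , o , c≡ , m≡ , mi₁ =
  subtree (children o) ∷
  subst (λ z → (d , node (eraseL ms₁)) ↝⁺ (d , node z)) c≡ (marked⇒↝⁺ d ms₁ k (suc-injective (trans m≡ eq)) mi₁)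

EdgeExpansion⇒↝⁺ : ∀ {T′ T} → EdgeExpansion T′ T → T′ ↝⁺ T
EdgeExpansion⇒↝⁺ ((d , mnode ms) , refl , mi , 1≤marks , refl) with marksL ms in eq
... | suc k = marked⇒↝⁺ d ms k eq mi

mutual
  unmarked : Node → MNode
  unmarked (node cs) = mnode (unmarkedL cs)

  unmarkedL : List (Dir × Node) → MList
  unmarkedL []             = []
  unmarkedL ((d , c) ∷ cs) = (d , false , unmarked c) ∷ unmarkedL cs

mutual
  eraseN-unmarked : ∀ c → eraseN (unmarked c) ≡ c
  eraseN-unmarked (node cs) = cong node (eraseL-unmarkedL cs)

  eraseL-unmarkedL : ∀ cs → eraseL (unmarkedL cs) ≡ cs
  eraseL-unmarkedL []             = refl
  eraseL-unmarkedL ((d , c) ∷ cs) = cong₂ (λ a b → (d , a) ∷ b) (eraseN-unmarked c) (eraseL-unmarkedL cs)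

mutual
  contractN-unmarked : ∀ c → contractN (unmarked c) ≡ c
  contractN-unmarked (node cs) = cong node (contractL-unmarkedL cs)

  contractL-unmarkedL : ∀ cs → contractL (unmarkedL cs) ≡ cs
  contractL-unmarkedL []             = refl
  contractL-unmarkedL ((d , c) ∷ cs) = cong₂ (λ a b → (d , a) ∷ b) (contractN-unmarked c) (contractL-unmarkedL cs)

mutual
  MarkedInteriorN-unmarked : ∀ c → MarkedInteriorN (unmarked c)
  MarkedInteriorN-unmarked (node cs) = MarkedInteriorL-unmarkedL cs

  MarkedInteriorL-unmarkedL : ∀ cs → MarkedInteriorL (unmarkedL cs)
  MarkedInteriorL-unmarkedL []             = tt
  MarkedInteriorL-unmarkedL ((_ , c) ∷ cs) = MarkedInteriorN-unmarked c , MarkedInteriorL-unmarkedL cs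

node-injective : ∀ {cs ds} → node cs ≡ node ds → cs ≡ ds
node-injective refl = refl

↝ₙ-interior : ∀ {x y} → x ↝ₙ y → IsInteriorNode x
↝ₙ-interior (children at)         = tt
↝ₙ-interior (children (under _))  = tt
↝ₙ-interior (children (beside _)) = tt

ExtendedMarkingN : Node → MNode → Set
ExtendedMarkingN c m₁ = Σ MNode λ m →
  eraseN m ≡ c × contractN m ≡ contractN m₁ × marksN m ≡ suc (marksN m₁) × MarkedInteriorN m

ExtendedMarkingL : List (Dir × Node) → MList → Set
ExtendedMarkingL cs ms₁ = Σ MList λ ms →
  eraseL ms ≡ cs × contractL ms ≡ contractL ms₁ × marksL ms ≡ suc (marksL ms₁) × MarkedInteriorL ms

mutual
  extendMarkingN : ∀ {c c₁} → c ↝ₙ c₁ → ∀ m₁ → eraseN m₁ ≡ c₁ → MarkedInteriorN m₁ → ExtendedMarkingN c m₁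
  extendMarkingN (children o) (mnode ms₁) refl mi with extendMarkingL o ms₁ refl mi
  ... | ms , e , c , k , mi′ = mnode ms , cong node e , cong node c , k , mi′

  extendMarkingL : ∀ {cs cs₁} → cs ↝ₗ cs₁ → ∀ ms₁ → eraseL ms₁ ≡ cs₁ → MarkedInteriorL ms₁ →
                   ExtendedMarkingL cs ms₁
  extendMarkingL (at {d} {e} {es} {cs}) ms₁ eq mi with eraseL-++⁻ ms₁ (e ∷ es) cs eq
  ... | ns , ms , refl , ns≡ , refl =
    (d , true , mnode ns) ∷ ms , cong (λ z → (d , node z) ∷ cs) ns≡ , sym (contractL-++ ns ms) ,
    cong suc (sym (marksL-++ ns ms)) , subst IsInteriorNode (cong node (sym ns≡)) tt ,
    MarkedInteriorL-++⁻ ns ms mi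
  extendMarkingL (under {d} o) ((.d , false , m) ∷ ms) refl (mm , mms) with extendMarkingN o m refl mm
  ... | m′ , refl , c , k , mm′ =
    (d , false , m′) ∷ ms , refl , cong (λ z → (d , z) ∷ contractL ms) c , cong (_+ marksL ms) k , mm′ , mms
  extendMarkingL (under {d} o) ((.d , true , mnode ns) ∷ ms) refl (_ , mm , mms)
    with extendMarkingN o (mnode ns) refl mm
  ... | mnode ns′ , refl , c , k , mm′ =
    (d , true , mnode ns′) ∷ ms , refl , cong (_++ contractL ms) (node-injective c) ,
    cong (λ z → suc (z + marksL ms)) k , ↝ₙ-interior o , mm′ , mms
  extendMarkingL (beside o) ((d , false , m) ∷ ms) eq (mm , mms) with ∷-injective eq
  ... | refl , eq′ with extendMarkingL o ms eq′ mms
  ... | ms′ , refl , c , k , mms′ =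
    (d , false , m) ∷ ms′ , refl , cong (_ ∷_) c , trans (cong (marksN m +_) k) (+-suc (marksN m) _) , mm , mms′
  extendMarkingL (beside o) ((d , true , mnode ns) ∷ ms) eq (i , mm , mms) with ∷-injective eq
  ... | refl , eq′ with extendMarkingL o ms eq′ mms
  ... | ms′ , refl , c , k , mms′ =
    (d , true , mnode ns) ∷ ms′ , refl , cong (contractL ns ++_) c ,
    cong suc (trans (cong (marksL ns +_) k) (+-suc (marksL ns) _)) , i , mm , mms′

↝-EdgeExpansion : ∀ {T′ T} → T′ ↝ T → EdgeExpansion T′ T
↝-EdgeExpansion (subtree {d} {v} {v′} o)
  with extendMarkingN o (unmarked v′) (eraseN-unmarked v′) (MarkedInteriorN-unmarked v′)
... | m , refl , c , k , mi =
  (d , m) , refl , mi , subst (1 ≤_) (sym k) (s≤s z≤n) , cong (d ,_) (trans c (contractN-unmarked v′))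

↝-EdgeExpansion-trans : ∀ {T′ T₁ T} → T′ ↝ T₁ → EdgeExpansion T₁ T → EdgeExpansion T′ T
↝-EdgeExpansion-trans (subtree {d} o) ((.d , m₁) , refl , mi₁ , _ , refl) with extendMarkingN o m₁ refl mi₁
... | m , refl , c , k , mi = (d , m) , refl , mi , subst (1 ≤_) (sym k) (s≤s z≤n) , cong (d ,_) c

↝⁺⇒EdgeExpansion : ∀ {T′ T} → T′ ↝⁺ T → EdgeExpansion T′ T
↝⁺⇒EdgeExpansion [ o ]   = ↝-EdgeExpansion o
↝⁺⇒EdgeExpansion (o ∷ r) = ↝-EdgeExpansion-trans o (↝⁺⇒EdgeExpansion r)

-- Orientation of the edges of an α-tree

m+n≤m⇒n≡0 : ∀ m {n} → m + n ≤ m → n ≡ 0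
m+n≤m⇒n≡0 m m+n≤m = n≤0⇒n≡0 (+-cancelˡ-≤ m _ 0 (subst (m + _ ≤_) (sym (+-identityʳ m)) m+n≤m))

m+n≤n⇒m≡0 : ∀ {m} n → m + n ≤ n → m ≡ 0
m+n≤n⇒m≡0 {m} n m+n≤n = m+n≤m⇒n≡0 n (subst (_≤ n) (+-comm m n) m+n≤n)

outsE-interior : ∀ d c cs → outsE (d , node (c ∷ cs)) ≡ outsL (c ∷ cs)
outsE-interior up   _ _ = refl
outsE-interior down _ _ = refl

DownChild : List (Dir × Node) → Set
DownChild = Any (λ c → proj₁ c ≡ down)

mutual
  outsE≡0⇒up : ∀ d c → WFNode d c → outsE (d , c) ≡ 0 → d ≡ up
  outsE≡0⇒up up   (node [])       _              _  = refl
  outsE≡0⇒up down (node [])       _              ()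
  outsE≡0⇒up d    (node (_ ∷ _)) (inj₁ d≡up , _) _  = d≡up
  outsE≡0⇒up d    (node (c ∷ cs)) (inj₂ h , _ , w) eq =
    ⊥-elim (outsL≡0⇒¬DownChild (c ∷ cs) w (trans (sym (outsE-interior d c cs)) eq) h)

  outsL≡0⇒¬DownChild : ∀ cs → WFList cs → outsL cs ≡ 0 → DownChild cs → ⊥
  outsL≡0⇒¬DownChild ((d , c) ∷ cs) (wc , _) eq (here d≡down)
    with trans (sym d≡down) (outsE≡0⇒up d c wc (m+n≡0⇒m≡0 (outsE (d , c)) eq))
  ... | ()
  outsL≡0⇒¬DownChild ((d , c) ∷ cs) (_ , w) eq (there h) = outsL≡0⇒¬DownChild cs w (m+n≡0⇒n≡0 (outsE (d , c)) eq) h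

-- N is the total number of outgoing exterior vertices: when they all lie on one side of the edge, it
-- points towards them.
TowardsOuts : ℕ → Dir → Node → Set
TowardsOuts N d c = (outsE (d , c) ≡ 0 → d ≡ up) × (N ≤ outsE (d , c) → d ≡ down)

mutual
  TowardsOutsN : ℕ → Node → Set
  TowardsOutsN N (node cs) = TowardsOutsL N cs

  TowardsOutsL : ℕ → List (Dir × Node) → Set
  TowardsOutsL N []             = ⊤
  TowardsOutsL N ((d , c) ∷ cs) = TowardsOuts N d c × TowardsOutsN N c × TowardsOutsL N cs

WellOriented : ℕ → Dir → Node → Set
WellOriented N d c = WFNode d c × TowardsOuts N d c × TowardsOutsN N c

mutual
  towardsOutsN : ∀ N d c → WFNode d c → outsE (d , c) ≤ N → (N ≤ outsE (d , c) → d ≡ down) → TowardsOutsN N c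
  towardsOutsN N d (node [])       _            _    _     = tt
  towardsOutsN N d (node (c ∷ cs)) (h , _ , w) outs≤N all⇒down =
    towardsOutsL N (c ∷ cs) w (subst (_≤ N) (outsE-interior d c cs) outs≤N) all⇒downChild
    where
    all⇒downChild : N ≤ outsL (c ∷ cs) → DownChild (c ∷ cs)
    all⇒downChild N≤outs = fromHasOut (all⇒down (subst (N ≤_) (sym (outsE-interior d c cs)) N≤outs)) h
      where
      fromHasOut : d ≡ down → HasOut d (c ∷ cs) → DownChild (c ∷ cs)
      fromHasOut refl (inj₂ h′) = h′

  towardsOutsL : ∀ N cs → WFList cs → outsL cs ≤ N → (N ≤ outsL cs → DownChild cs) → TowardsOutsL N cs
  towardsOutsL N []             _         _      _ = tt
  towardsOutsL N ((d , c) ∷ cs) (wc , w) outs≤N all⇒downChild =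
    (outsE≡0⇒up d c wc , all⇒down) ,
    towardsOutsN N d c wc (≤-trans (m≤m+n _ _) outs≤N) all⇒down ,
    towardsOutsL N cs w (≤-trans (m≤n+m _ _) outs≤N) all⇒downLater
    where
    all⇒down : N ≤ outsE (d , c) → d ≡ down
    all⇒down N≤outs with all⇒downChild (≤-trans N≤outs (m≤m+n _ _))
    ... | here d≡down = d≡down
    ... | there h = ⊥-elim (outsL≡0⇒¬DownChild cs w (m+n≤m⇒n≡0 (outsE (d , c)) (≤-trans outs≤N N≤outs)) h)

    all⇒downLater : N ≤ outsL cs → DownChild cs
    all⇒downLater N≤outs with all⇒downChild (≤-trans N≤outs (m≤n+m _ _))
                            | outsE≡0⇒up d c wc (m+n≤n⇒m≡0 (outsL cs) (≤-trans outs≤N N≤outs))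
    ... | here refl | ()
    ... | there h   | _ = h

wellOriented-root : ∀ d v → WFNode d v → WellOriented (totalOuts (d , v)) d v
wellOriented-root d v w = w , (outsE≡0⇒up d v w , all⇒down d) , towardsOutsN _ d v w (m≤n+m _ _) (all⇒down d)
  where
  all⇒down : ∀ d → totalOuts (d , v) ≤ outsE (d , v) → d ≡ down
  all⇒down down _      = refl
  all⇒down up   1+o≤o = ⊥-elim (n≮n _ 1+o≤o)

-- Spine labels

inSpine-true : ∀ N e → outsE e ≢ 0 → ¬ N ≤ outsE e → inSpine N e ≡ true
inSpine-true N e = go (outsE e)
  where
  go : ∀ n → n ≢ 0 → ¬ N ≤ n → ((0 <ᵇ n) ∧ (n <ᵇ N)) ≡ true
  go zero    n≢0 _   = ⊥-elim (n≢0 refl)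
  go (suc n) _   N≰n = Equivalence.to T-≡ (<⇒<ᵇ (≰⇒> N≰n))

inSpine-false : ∀ N e → inSpine N e ≡ false → outsE e ≡ 0 ⊎ N ≤ outsE e
inSpine-false N e = go (outsE e)
  where
  go : ∀ n → ((0 <ᵇ n) ∧ (n <ᵇ N)) ≡ false → n ≡ 0 ⊎ N ≤ n
  go zero    _   = inj₁ refl
  go (suc n) eq  = inj₂ (≮⇒≥ λ n<N → true≢false (trans (sym (Equivalence.to T-≡ (<⇒<ᵇ n<N))) eq))
    where
    true≢false : true ≢ false
    true≢false ()

inSpine-cong : ∀ N e e′ → outsE e ≡ outsE e′ → inSpine N e ≡ inSpine N e′
inSpine-cong N _ _ = cong (λ n → (0 <ᵇ n) ∧ (n <ᵇ N))

outsE-bivalent : ∀ d e → outsE (d , node (e ∷ [])) ≡ outsE e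
outsE-bivalent d e = trans (outsE-interior d e []) (+-identityʳ (outsE e))

bivalent-inSpine : ∀ N d c → isBivalent c ≡ true → WellOriented N d c → inSpine N (d , c) ≡ true
bivalent-inSpine N d (node ((d₁ , c₁) ∷ [])) _ (w , (_ , all⇒down) , (none⇒up , _) , _) with bivalent-orientation w
... | refl , refl = inSpine-true N (up , node ((down , c₁) ∷ [])) outs≢0 N≰outs
  where
  outs≢0 : outsE (down , c₁) + 0 ≢ 0
  outs≢0 eq with none⇒up (m+n≡0⇒m≡0 _ eq)
  ... | ()
  N≰outs : ¬ N ≤ outsE (down , c₁) + 0
  N≰outs N≤outs with all⇒down N≤outs
  ... | ()

bivalent-child-inSpine : ∀ N d e → inSpine N (d , node (e ∷ [])) ≡ true → inSpine N e ≡ true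
bivalent-child-inSpine N d e = trans (inSpine-cong N e (d , node (e ∷ [])) (sym (outsE-bivalent d e)))

data NotBoth : Lab → Set where
  none : NotBoth none
  ori  : ∀ d → NotBoth (ori d)

labOf-cong : ∀ N d c c′ → outsE (d , c) ≡ outsE (d , c′) → isBivalent c ≡ isBivalent c′ →
             labOf N d c ≡ labOf N d c′
labOf-cong N d _ _ outs≡ biv≡ =
  cong₂ (λ s b → if s then (if b then both else ori d) else none) (inSpine-cong N (d , _) (d , _) outs≡) biv≡

labOf-bivalent : ∀ N d c → isBivalent c ≡ true → inSpine N (d , c) ≡ true → labOf N d c ≡ both
labOf-bivalent N d c b s rewrite b | s = refl

labOf-nonBivalent : ∀ N d c → isBivalent c ≡ false → inSpine N (d , c) ≡ true → labOf N d c ≡ ori d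
labOf-nonBivalent N d c b s rewrite b | s = refl

labOf-NotBoth : ∀ N d c → isBivalent c ≡ false → NotBoth (labOf N d c)
labOf-NotBoth N d c b with inSpine N (d , c)
... | false = none
... | true rewrite b = ori d

labOf≡both⇒ : ∀ N d c → labOf N d c ≡ both → isBivalent c ≡ true × inSpine N (d , c) ≡ true
labOf≡both⇒ N d c eq with inSpine N (d , c) | isBivalent c | eq
... | true | true | _ = refl , refl

labOf≡ori⇒ : ∀ N d c {d′} → labOf N d c ≡ ori d′ → isBivalent c ≡ false × inSpine N (d , c) ≡ true × d′ ≡ d
labOf≡ori⇒ N d c eq with inSpine N (d , c) | isBivalent c | eq
... | true | false | refl = refl , refl , refl

bivalent-labOf : ∀ N d c → isBivalent c ≡ true → WellOriented N d c → labOf N d c ≡ both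
bivalent-labOf N d c b wo = labOf-bivalent N d c b (bivalent-inSpine N d c b wo)

bivalent-child-labOf : ∀ N d d₁ c₁ → WFNode d (node ((d₁ , c₁) ∷ [])) →
                       inSpine N (d , node ((d₁ , c₁) ∷ [])) ≡ true →
                       labOf N d₁ c₁ ≡ ori d₁
bivalent-child-labOf N d d₁ c₁ w s =
  labOf-nonBivalent N d₁ c₁ (bivalent-child-nonBivalent w) (bivalent-child-inSpine N d (d₁ , c₁) s)

bivalent-child-labOf′ : ∀ N d d₁ c₁ → WellOriented N d (node ((d₁ , c₁) ∷ [])) → labOf N d₁ c₁ ≡ ori d₁
bivalent-child-labOf′ N d d₁ c₁ wo = bivalent-child-labOf N d d₁ c₁ (proj₁ wo) (bivalent-inSpine N d _ refl wo)

-- The image of a contraction under f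

shapeOf-nonBivalent : ∀ N cs → isBivalent (node cs) ≡ false → shapeOf N (node cs) ≡ lnode (procL N cs)
shapeOf-nonBivalent N []          _ = refl
shapeOf-nonBivalent N (_ ∷ _ ∷ _) _ = refl

procL-++ : ∀ N cs ds → procL N (cs ++ ds) ≡ procL N cs ++ procL N ds
procL-++ N []             ds = refl
procL-++ N ((d , c) ∷ cs) ds = cong (_ ∷_) (procL-++ N cs ds)

↝ₗ-nonBivalent : ∀ {c₁ c₂ cs ds} → c₁ ∷ c₂ ∷ cs ↝ₗ ds → isBivalent (node ds) ≡ false
↝ₗ-nonBivalent (at {es = []})          = refl
↝ₗ-nonBivalent (at {es = _ ∷ _})       = refl
↝ₗ-nonBivalent (under _)               = refl
↝ₗ-nonBivalent (beside {ds = _ ∷ _} _) = refl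

data FormalExp₁N (y x : LNode) : Set where
  relabel  : RelabelN y x → FormalExp₁N y x
  contract : ∀ {l} → NotBoth l → ContrN x y l → FormalExp₁N y x

data FormalExp₁L (ys xs : List (Lab × LNode)) : Set where
  relabel  : RelabelL ys xs → FormalExp₁L ys xs
  contract : ∀ {l} → NotBoth l → ContrL xs ys l → FormalExp₁L ys xs

FormalExp₁L-∷ : ∀ {l l′ x x′ ps} → FormalExp₁ (l′ , x′) (l , x) →
                FormalExp₁L ((l′ , x′) ∷ ps) ((l , x) ∷ ps)
FormalExp₁L-∷ (relabel rroot)           = relabel rhere
FormalExp₁L-∷ (relabel (rinner r))      = relabel (rdown r)
FormalExp₁L-∷ (offSpine (refl , cn))    = contract none (cdown cn)
FormalExp₁L-∷ (onSpine {d = d} (refl , cn)) = contract (ori d) (cdown cn)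

FormalExp₁L-beside : ∀ {p ys xs} → FormalExp₁L ys xs → FormalExp₁L (p ∷ ys) (p ∷ xs)
FormalExp₁L-beside (relabel r)     = relabel (rtail r)
FormalExp₁L-beside (contract l cn) = contract l (ctail cn)

-- Besides changing the shape by a formal one-edge expansion, a contraction inside c may merge a
-- bivalent c with its child: the shape stays, but the edge above c loses its ↔.
data ShapeStep (N : ℕ) (c c′ : Node) : Set where
  inner   : FormalExp₁N (shapeOf N c′) (shapeOf N c) → isBivalent c ≡ isBivalent c′ → ShapeStep N c c′
  unmerge : shapeOf N c ≡ shapeOf N c′ → isBivalent c ≡ true → isBivalent c′ ≡ false → ShapeStep N c c′

mutual
  edgeStep : ∀ N d {c c′} → WellOriented N d c → c ↝ₙ c′ →
             FormalExp₁ (labOf N d c′ , shapeOf N c′) (labOf N d c , shapeOf N c)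
  edgeStep N d {c} {c′} wo@(w , _ , tc) o with shapeStepN N d w tc o
  ... | inner s biv≡ rewrite labOf-cong N d c′ c (sym (↝ₙ-outsE d o)) (sym biv≡) = lift s
    where
    lift : ∀ {l y x} → FormalExp₁N y x → FormalExp₁ (l , y) (l , x)
    lift (relabel r)              = relabel (rinner r)
    lift (contract none cn)       = offSpine (refl , cn)
    lift (contract (ori _) cn)    = onSpine (refl , cn)
  ... | unmerge shape≡ biv nonBiv
    rewrite bivalent-labOf N d c biv wo
          | labOf-nonBivalent N d c′ nonBiv
              (trans (inSpine-cong N (d , c′) (d , c) (sym (↝ₙ-outsE d o))) (bivalent-inSpine N d c biv wo))
    = subst (λ y → FormalExp₁ (ori d , y) (both , shapeOf N c)) shape≡ (relabel rroot)

  shapeStepN : ∀ N d {c c′} → WFNode d c → TowardsOutsN N c → c ↝ₙ c′ → ShapeStep N c c′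
  shapeStepN N d {node ((_ , node (_ ∷ [])) ∷ [])} w _ (children at) with bivalent-child-nonBivalent w
  ... | ()
  shapeStepN N d {node ((_ , node (e ∷ e₂ ∷ es)) ∷ [])} _ _ (children at) =
    unmerge (cong (λ z → lnode (procL N (e ∷ e₂ ∷ z))) (sym (++-identityʳ es))) refl refl
  shapeStepN N d {node ((d₁ , _) ∷ [])} w@(_ , _ , w₁ , _) (_ , tc₁ , _) (children (under o))
    with shapeStepN N d₁ w₁ tc₁ o
  ... | inner s _ = inner s refl
  ... | unmerge _ biv _ with trans (sym biv) (bivalent-child-nonBivalent w)
  ...   | ()
  shapeStepN N d {node (_ ∷ _ ∷ _)} {node cs′} (_ , _ , ws) tcs (children o) =
    inner (subst (λ y → FormalExp₁N y _) (sym (shapeOf-nonBivalent N cs′ (↝ₗ-nonBivalent o)))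
                 (lift (shapeStepL N ws tcs o)))
          (sym (↝ₗ-nonBivalent o))
    where
    lift : ∀ {ys xs} → FormalExp₁L ys xs → FormalExp₁N (lnode ys) (lnode xs)
    lift (relabel r)     = relabel (rnode r)
    lift (contract l cl) = contract l (cnode cl)

  shapeStepL : ∀ N {cs cs′} → WFList cs → TowardsOutsL N cs → cs ↝ₗ cs′ → FormalExp₁L (procL N cs′) (procL N cs)
  shapeStepL N {(d , node ((d₁ , c₁) ∷ [])) ∷ _} (w , _) (t , tc , _) at
    rewrite bivalent-labOf N d (node ((d₁ , c₁) ∷ [])) refl (w , t , tc)
          | bivalent-child-labOf′ N d d₁ c₁ (w , t , tc)
    = relabel rhere
  shapeStepL N {(d , node (e ∷ e₂ ∷ es)) ∷ cs} _ _ at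
    rewrite procL-++ N (e ∷ e₂ ∷ es) cs
    = contract (labOf-NotBoth N d (node (e ∷ e₂ ∷ es)) refl) chere
  shapeStepL N {(d , _) ∷ _} (w , _) (t , tc , _) (under o) = FormalExp₁L-∷ (edgeStep N d (w , t , tc) o)
  shapeStepL N (_ , ws) (_ , _ , tcs) (beside o) = FormalExp₁L-beside (shapeStepL N ws tcs o)

↝⇒FormalExp₁ : ∀ {α T′ T} → IsAlphaTree α T′ → T′ ↝ T → FormalExp₁ (f T) (f T′)
↝⇒FormalExp₁ {T′ = d , v} (_ , _ , w) (subtree {v′ = v′} o) =
  subst (λ N → FormalExp₁ (labOf N d v′ , shapeOf N v′) (f (d , v))) (sym (↝ₙ-totalOuts d o))
        (edgeStep _ d (wellOriented-root d v w) o)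

-- Lifting formal one-edge expansions to contractions

-- An up edge at a leaf is an in-leaf, off the spine; hence no relabelling ori up ↦ ↔ happens on a leaf edge.
NoUpLeaf : Lab → LNode → Set
NoUpLeaf l x = l ≡ ori up → x ≢ lnode []

mutual
  NoUpLeavesN : LNode → Set
  NoUpLeavesN (lnode ps) = NoUpLeavesL ps

  NoUpLeavesL : List (Lab × LNode) → Set
  NoUpLeavesL []             = ⊤
  NoUpLeavesL ((l , x) ∷ ps) = NoUpLeaf l x × NoUpLeavesN x × NoUpLeavesL ps

noUpLeaf : ∀ N d c → NoUpLeaf (labOf N d c) (shapeOf N c)
noUpLeaf N d c eq with labOf≡ori⇒ N d c eq
noUpLeaf N up (node [])          eq | _ , () , refl
noUpLeaf N up (node (_ ∷ _ ∷ _)) eq | _ = λ ()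

mutual
  noUpLeavesN : ∀ N c → NoUpLeavesN (shapeOf N c)
  noUpLeavesN N (node [])              = tt
  noUpLeavesN N (node ((_ , c) ∷ []))  = noUpLeavesN N c
  noUpLeavesN N (node cs@(_ ∷ _ ∷ _)) = noUpLeavesL N cs

  noUpLeavesL : ∀ N cs → NoUpLeavesL (procL N cs)
  noUpLeavesL N []             = tt
  noUpLeavesL N ((d , c) ∷ cs) = noUpLeaf N d c , noUpLeavesN N c , noUpLeavesL N cs

-- Relabelling ori down ↦ ↔ on the root edge would require contracting the root edge, which is not interior.
rootLabel≢ori-down : ∀ d v → labOf (totalOuts (d , v)) d v ≢ ori down
rootLabel≢ori-down d v eq with labOf≡ori⇒ (totalOuts (d , v)) d v eq
... | _ , s , refl = n≮n o (<ᵇ⇒< o o (proj₂ (Equivalence.to T-∧ (Equivalence.from T-≡ s))))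
  where o = outsE (down , v)

Lifted : ℕ → Node → LNode → Set
Lifted N c y = Σ Node λ c″ → c ↝ₙ c″ × shapeOf N c″ ≡ y × isBivalent c″ ≡ isBivalent c

LiftedL : ℕ → List (Dir × Node) → List (Lab × LNode) → Set
LiftedL N cs ps = Σ (List (Dir × Node)) λ cs″ → cs ↝ₗ cs″ × procL N cs″ ≡ ps

liftedL⇒lifted : ∀ N {c₁ c₂ cs ps} → LiftedL N (c₁ ∷ c₂ ∷ cs) ps → Lifted N (node (c₁ ∷ c₂ ∷ cs)) (lnode ps)
liftedL⇒lifted N (cs″ , o , eq) =
  node cs″ , children o , trans (shapeOf-nonBivalent N cs″ (↝ₗ-nonBivalent o)) (cong lnode eq) , ↝ₗ-nonBivalent o

lifted-edge : ∀ N d {c y} → Lifted N c y →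
              Σ Node λ c″ → c ↝ₙ c″ × (labOf N d c″ , shapeOf N c″) ≡ (labOf N d c , y)
lifted-edge N d {c} (c″ , o , s , b) = c″ , o , cong₂ _,_ (labOf-cong N d c″ c (sym (↝ₙ-outsE d o)) b) s

lifted-under : ∀ N d {c y cs} → Lifted N c y → LiftedL N ((d , c) ∷ cs) ((labOf N d c , y) ∷ procL N cs)
lifted-under N d {cs = cs} l with lifted-edge N d l
... | c″ , o , e = (d , c″) ∷ cs , under o , cong (_∷ procL N cs) e

lifted-beside : ∀ N {d c cs ps} → LiftedL N cs ps → LiftedL N ((d , c) ∷ cs) ((labOf N d c , shapeOf N c) ∷ ps)
lifted-beside N (cs″ , o , s) = _ ∷ cs″ , beside o , cong (_ ∷_) s

unmergeBelow : ∀ N d c → WFNode d c → labOf N d c ≡ both → NoUpLeaf (ori up) (shapeOf N c) →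
               Σ Node λ c″ → c ↝ₙ c″ × labOf N d c″ ≡ ori up × shapeOf N c″ ≡ shapeOf N c
unmergeBelow N d c w lab noUp with labOf≡both⇒ N d c lab
unmergeBelow N d (node (_ ∷ [])) w lab noUp | _ , s with bivalent-orientation w
unmergeBelow N up (node ((down , node []) ∷ [])) w lab noUp | _ , s | refl , refl = ⊥-elim (noUp refl refl)
unmergeBelow N up (node ((down , node (_ ∷ [])) ∷ [])) w lab noUp | _ , s | refl , refl
  with bivalent-child-nonBivalent w
... | ()
unmergeBelow N up b@(node ((down , node (z ∷ z₂ ∷ zs)) ∷ [])) w lab noUp | _ , s | refl , refl =
  c″ , o , labOf-nonBivalent N up c″ refl (trans (inSpine-cong N (up , c″) (up , b) (sym (↝ₙ-outsE up o))) s) ,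
  cong (λ zs′ → lnode (procL N (z ∷ z₂ ∷ zs′))) (++-identityʳ zs)
  where
  c″ = node ((z ∷ z₂ ∷ zs) ++ [])
  o : b ↝ₙ c″
  o = children at

-- A ↔ edge runs up through a bivalent vertex and then down: contracting its lower half leaves ori up,
-- contracting its upper half leaves ori down.
liftRelabelHere : ∀ N d c d′ cs → WFNode d c → labOf N d c ≡ both → NoUpLeaf (ori d′) (shapeOf N c) →
                  LiftedL N ((d , c) ∷ cs) ((ori d′ , shapeOf N c) ∷ procL N cs)
liftRelabelHere N d c up cs w lab noUp with unmergeBelow N d c w lab noUp
... | c″ , o , lab″ , shape″ = (d , c″) ∷ cs , under o , cong₂ (λ l x → (l , x) ∷ procL N cs) lab″ shape″
liftRelabelHere N d c down cs w lab _ with labOf≡both⇒ N d c lab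
liftRelabelHere N d (node ((_ , c₁) ∷ [])) down cs w lab _ | _ , s with bivalent-orientation w
... | refl , refl =
  (down , c₁) ∷ cs , at , cong (λ l → (l , shapeOf N c₁) ∷ procL N cs) (bivalent-child-labOf N up down c₁ w s)

mutual
  liftN : ∀ N d c {x y} → WFNode d c → TowardsOutsN N c → NoUpLeavesN y → FormalExp₁N y x → x ≡ shapeOf N c →
          Lifted N c y
  liftN N d (node []) _ _ _ (relabel (rnode ()))     refl
  liftN N d (node []) _ _ _ (contract _ (cnode ()))  refl
  liftN N d (node ((d₁ , c₁) ∷ [])) (_ , _ , w₁ , _) (_ , tc₁ , _) noUp step eq
    with liftN N d₁ c₁ w₁ tc₁ noUp step eq
  ... | c″ , o , s , _ = node ((d₁ , c″) ∷ []) , children (under o) , s , refl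
  liftN N d (node cs@(_ ∷ _ ∷ _)) (_ , _ , ws) tcs noUp (relabel (rnode r)) refl =
    liftedL⇒lifted N (liftL N cs ws tcs noUp (relabel r) refl)
  liftN N d (node cs@(_ ∷ _ ∷ _)) (_ , _ , ws) tcs noUp (contract l (cnode cl)) refl =
    liftedL⇒lifted N (liftL N cs ws tcs noUp (contract l cl) refl)

  liftL : ∀ N cs {qs ps} → WFList cs → TowardsOutsL N cs → NoUpLeavesL ps → FormalExp₁L ps qs → qs ≡ procL N cs →
          LiftedL N cs ps
  liftL N [] _ _ _ (relabel ())    refl
  liftL N [] _ _ _ (contract _ ()) refl
  liftL N ((d , c) ∷ cs) (w , _) _ (noUp , _) (relabel (rhere {d = d′})) eq
    with ,-injectiveˡ (∷-injectiveˡ eq) | ,-injectiveʳ (∷-injectiveˡ eq) | ∷-injectiveʳ eq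
  ... | lab | refl | refl = liftRelabelHere N d c d′ cs w (sym lab) noUp
  liftL N ((d , c) ∷ cs) (w , _) (_ , tc , _) (_ , noUps , _) (relabel (rdown r)) refl =
    lifted-under N d (liftN N d c w tc noUps (relabel r) refl)
  liftL N (_ ∷ cs) (_ , ws) (_ , _ , tcs) (_ , _ , noUps) (relabel (rtail r)) refl =
    lifted-beside N (liftL N cs ws tcs noUps (relabel r) refl)
  liftL N ((d , node []) ∷ cs) _ _ _ (contract _ chere) ()
  liftL N ((d , node ((d₁ , c₁) ∷ [])) ∷ cs) (w , _) (t , tc , _) _ (contract l chere) eq
    with subst NotBoth (trans (,-injectiveˡ (∷-injectiveˡ eq)) (bivalent-labOf N d _ refl (w , t , tc))) l
  ... | ()
  liftL N ((d , node cs₁@(_ ∷ _ ∷ _)) ∷ cs) _ _ _ (contract l chere) refl =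
    cs₁ ++ cs , at , procL-++ N cs₁ cs
  liftL N ((d , c) ∷ cs) (w , _) (_ , tc , _) (_ , noUps , _) (contract l (cdown cn)) refl =
    lifted-under N d (liftN N d c w tc noUps (contract l cn) refl)
  liftL N (_ ∷ cs) (_ , ws) (_ , _ , tcs) (_ , _ , noUps) (contract l (ctail cl)) refl =
    lifted-beside N (liftL N cs ws tcs noUps (contract l cl) refl)

liftEdge : ∀ N d c {l x X′} → WFNode d c → TowardsOutsN N c → NoUpLeaf l x → NoUpLeavesN x → l ≢ ori down →
           FormalExp₁ (l , x) X′ → X′ ≡ (labOf N d c , shapeOf N c) →
           Σ Node λ c″ → c ↝ₙ c″ × (labOf N d c″ , shapeOf N c″) ≡ (l , x)
liftEdge N d c _ _ _ _ ≢down (relabel (rroot {d = down})) _ = ⊥-elim (≢down refl)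
liftEdge N d c w _ noUp _ _ (relabel (rroot {d = up})) eq with ,-injectiveˡ eq | ,-injectiveʳ eq
... | lab | refl with unmergeBelow N d c w (sym lab) noUp
...   | c″ , o , lab″ , shape″ = c″ , o , cong₂ _,_ lab″ shape″
liftEdge N d c w tc _ noUps _ (relabel (rinner r)) refl = lifted-edge N d (liftN N d c w tc noUps (relabel r) refl)
liftEdge N d c w tc _ noUps _ (offSpine (refl , cn)) refl = lifted-edge N d (liftN N d c w tc noUps (contract none cn) refl)
liftEdge N d c w tc _ noUps _ (onSpine {d = d′} (refl , cn)) refl =
  lifted-edge N d (liftN N d c w tc noUps (contract (ori d′) cn) refl)

liftFormalExp₁ : ∀ {α} T {T′} → IsAlphaTree α T′ → FormalExp₁ (f T) (f T′) →
                 Σ Tree λ T″ → T′ ↝ T″ × f T″ ≡ f T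
liftFormalExp₁ (e , u) {d , v} (_ , _ , w) step
  with liftEdge (totalOuts (d , v)) d v w (proj₂ (proj₂ (wellOriented-root d v w)))
         (noUpLeaf (totalOuts (e , u)) e u) (noUpLeavesN (totalOuts (e , u)) u) (rootLabel≢ori-down e u) step refl
... | v″ , o , eq = (d , v″) , subtree o ,
  trans (cong (λ N → labOf N d v″ , shapeOf N v″) (↝ₙ-totalOuts d o)) eq

-- Injectivity of f on α-trees

lnode-injective : ∀ {ps qs} → lnode ps ≡ lnode qs → ps ≡ qs
lnode-injective refl = refl

++-injective : ∀ {A : Set} (xs xs′ : List A) {ys ys′} → length xs ≡ length xs′ → xs ++ ys ≡ xs′ ++ ys′ →
               xs ≡ xs′ × ys ≡ ys′
++-injective []       []        _   eq = refl , eq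
++-injective (x ∷ xs) (x′ ∷ xs′) len eq with ∷-injective eq
... | refl , eq′ with ++-injective xs xs′ (suc-injective len) eq′
...   | refl , eq″ = refl , eq″

leafLbl-injective : ∀ {d d′} → leafLbl d ≡ leafLbl d′ → d ≡ d′
leafLbl-injective {up}   {up}   _ = refl
leafLbl-injective {down} {down} _ = refl

rootLbl-injective : ∀ {d d′} → rootLbl d ≡ rootLbl d′ → d ≡ d′
rootLbl-injective {up}   {up}   _ = refl
rootLbl-injective {down} {down} _ = refl

mutual
  leavesN : LNode → ℕ
  leavesN (lnode [])       = 1
  leavesN (lnode (p ∷ ps)) = leavesL (p ∷ ps)

  leavesL : List (Lab × LNode) → ℕ
  leavesL []             = 0
  leavesL ((_ , x) ∷ ps) = leavesN x + leavesL ps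

mutual
  length-edgeWord : ∀ N d c → length (edgeWord (d , c)) ≡ leavesN (shapeOf N c)
  length-edgeWord N d (node [])                = refl
  length-edgeWord N d (node ((d₁ , c₁) ∷ []))  =
    trans (cong length (edgeWord-bivalent d (d₁ , c₁))) (length-edgeWord N d₁ c₁)
  length-edgeWord N d (node cs@(_ ∷ _ ∷ _))    = length-leafWordL N cs

  length-leafWordL : ∀ N cs → length (leafWordL cs) ≡ leavesL (procL N cs)
  length-leafWordL N []             = refl
  length-leafWordL N ((d , c) ∷ cs) = begin
    length (leafWordL ((d , c) ∷ cs))                 ≡⟨ cong length (leafWordL-∷ (d , c) cs) ⟩
    length (edgeWord (d , c) ++ leafWordL cs)         ≡⟨ length-++ (edgeWord (d , c)) ⟩
    length (edgeWord (d , c)) + length (leafWordL cs) ≡⟨ cong₂ _+_ (length-edgeWord N d c) (length-leafWordL N cs) ⟩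
    leavesN (shapeOf N c) + leavesL (procL N cs)      ∎
    where open ≡-Reasoning

orientation-determined : ∀ N d d′ c c′ → isBivalent c ≡ false → TowardsOuts N d c → TowardsOuts N d′ c′ →
                         labOf N d c ≡ labOf N d′ c′ → outsE (d , c) ≡ outsE (d′ , c′) → d ≡ d′
orientation-determined N d d′ c c′ nonBiv (none⇒up , all⇒down) (none⇒up′ , all⇒down′) lab outs =
  bySpine (inSpine N (d , c)) refl
  where
  bySpine : ∀ s → inSpine N (d , c) ≡ s → d ≡ d′
  bySpine true  spine = proj₂ (proj₂ (labOf≡ori⇒ N d′ c′ (trans (sym lab) (labOf-nonBivalent N d c nonBiv spine))))
  bySpine false spine with inSpine-false N (d , c) spine
  ... | inj₁ noOuts  = trans (none⇒up noOuts) (sym (none⇒up′ (trans (sym outs) noOuts)))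
  ... | inj₂ allOuts = trans (all⇒down allOuts) (sym (all⇒down′ (subst (N ≤_) outs allOuts)))

bivalent-transfer : ∀ N d d′ c c′ → WellOriented N d′ c′ → labOf N d c ≡ labOf N d′ c′ →
                    isBivalent c′ ≡ true → isBivalent c ≡ true
bivalent-transfer N d d′ c c′ wo′ lab biv′ =
  proj₁ (labOf≡both⇒ N d c (trans lab (bivalent-labOf N d′ c′ biv′ wo′)))

shapeOf≡⇒length-edgeWord≡ : ∀ N d d′ c c′ → shapeOf N c ≡ shapeOf N c′ →
                            length (edgeWord (d , c)) ≡ length (edgeWord (d′ , c′))
shapeOf≡⇒length-edgeWord≡ N d d′ c c′ eq =
  trans (length-edgeWord N d c) (trans (cong leavesN eq) (sym (length-edgeWord N d′ c′)))

bivalent-child-WellOriented : ∀ N d d₁ c₁ → WellOriented N d (node ((d₁ , c₁) ∷ [])) → WellOriented N d₁ c₁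
bivalent-child-WellOriented N d d₁ c₁ ((_ , _ , w₁ , _) , _ , t₁ , tc₁ , _) = w₁ , t₁ , tc₁

mutual
  edge-injective : ∀ N d d′ c c′ → WellOriented N d c → WellOriented N d′ c′ →
                   labOf N d c ≡ labOf N d′ c′ → shapeOf N c ≡ shapeOf N c′ →
                   edgeWord (d , c) ≡ edgeWord (d′ , c′) → d ≡ d′ × c ≡ c′
  edge-injective N d d′ (node []) (node []) _ _ _ _ word = leafLbl-injective (∷-injectiveˡ word) , refl
  edge-injective N d d′ (node []) (node (_ ∷ [])) _ o′ lab _ _ with bivalent-transfer N d d′ _ _ o′ lab refl
  ... | ()
  edge-injective N d d′ (node (_ ∷ [])) (node []) o _ lab _ _ with bivalent-transfer N d′ d _ _ o (sym lab) refl
  ... | ()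
  edge-injective N d d′ (node []) (node (_ ∷ _ ∷ _)) _ _ _ () _
  edge-injective N d d′ (node (_ ∷ _ ∷ _)) (node []) _ _ _ () _
  edge-injective N d d′ (node (_ ∷ _ ∷ _)) (node (_ ∷ [])) _ o′ lab _ _ with bivalent-transfer N d d′ _ _ o′ lab refl
  ... | ()
  edge-injective N d d′ (node (_ ∷ [])) (node (_ ∷ _ ∷ _)) o _ lab _ _ with bivalent-transfer N d′ d _ _ o (sym lab) refl
  ... | ()
  edge-injective N d d′ (node ((d₁ , c₁) ∷ [])) (node ((d₁′ , c₁′) ∷ [])) o o′ _ shape word
    with bivalent-orientation (proj₁ o) | bivalent-orientation (proj₁ o′)
  ... | refl , refl | refl , refl
    with edge-injective N down down c₁ c₁′
           (bivalent-child-WellOriented N up down c₁ o) (bivalent-child-WellOriented N up down c₁′ o′)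
           (trans (bivalent-child-labOf′ N up down c₁ o) (sym (bivalent-child-labOf′ N up down c₁′ o′))) shape
           (trans (sym (edgeWord-bivalent up (down , c₁))) (trans word (edgeWord-bivalent up (down , c₁′))))
  ...   | _ , refl = refl , refl
  edge-injective N d d′ (node cs@(_ ∷ _ ∷ _)) (node cs′@(_ ∷ _ ∷ _))
                 ((_ , _ , ws) , t , tcs) ((_ , _ , ws′) , t′ , tcs′) lab shape word =
    orientation-determined N d d′ (node cs) (node cs′) refl t t′ lab
      (edgeWord≡⇒outsE≡ (d , node cs) (d′ , node cs′) word) ,
    cong node (children-injective N cs cs′ ws ws′ tcs tcs′ (lnode-injective shape) word)

  children-injective : ∀ N cs cs′ → WFList cs → WFList cs′ → TowardsOutsL N cs → TowardsOutsL N cs′ →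
                       procL N cs ≡ procL N cs′ → leafWordL cs ≡ leafWordL cs′ → cs ≡ cs′
  children-injective N []             []               _ _ _ _ _ _ = refl
  children-injective N ((d , c) ∷ cs) ((d′ , c′) ∷ cs′) (w , ws) (w′ , ws′) (t , tc , tcs) (t′ , tc′ , tcs′)
                     proc word
    with ∷-injective proc
  ... | head , procs
    with ++-injective (edgeWord (d , c)) (edgeWord (d′ , c′))
           (shapeOf≡⇒length-edgeWord≡ N d d′ c c′ (,-injectiveʳ head))
           (trans (sym (leafWordL-∷ (d , c) cs)) (trans word (leafWordL-∷ (d′ , c′) cs′)))
  ... | word₁ , words
    with edge-injective N d d′ c c′ (w , t , tc) (w′ , t′ , tc′) (,-injectiveˡ head) (,-injectiveʳ head) word₁
  ... | refl , refl = cong (_ ∷_) (children-injective N cs cs′ ws ws′ tcs tcs′ procs words)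

f-injective : ∀ {α T T′} → IsAlphaTree α T → IsAlphaTree α T′ → f T ≡ f T′ → T ≡ T′
f-injective {T = d , v@(node (_ ∷ _))} {d′ , v′@(node (_ ∷ _))} αT@(_ , word≡ , w) αT′@(_ , word≡′ , w′) eq
  with ∷-injective (trans word≡ (sym word≡′))
... | root , leaves with rootLbl-injective root
... | refl =
  cong (d ,_) (proj₂ (edge-injective N d d v v′ (wellOriented-root d v w) wo′ (,-injectiveˡ eq′) (,-injectiveʳ eq′) leaves))
  where
  N = totalOuts (d , v)
  N≡ : totalOuts (d , v′) ≡ N
  N≡ = trans (totalOuts≡outCount αT′) (sym (totalOuts≡outCount αT))
  eq′ : f (d , v) ≡ (labOf N d v′ , shapeOf N v′)
  eq′ = subst (λ M → f (d , v) ≡ (labOf M d v′ , shapeOf M v′)) N≡ eq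
  wo′ : WellOriented N d v′
  wo′ = subst (λ M → WellOriented M d v′) N≡ (wellOriented-root d v′ w′)

↝⇒FormalExp₁α : ∀ {α T′ T} → IsAlphaTree α T′ → T′ ↝ T → FormalExp₁α α (f T) (f T′)
↝⇒FormalExp₁α {T′ = T′} {T} αT′ o =
  (T , ↝-IsAlphaTree αT′ o , refl) , (T′ , αT′ , refl) , ↝⇒FormalExp₁ αT′ o

↝⁺⇒FormalEdgeExpansion : ∀ {α T′ T} → IsAlphaTree α T′ → T′ ↝⁺ T → FormalEdgeExpansion α (f T) (f T′)
↝⁺⇒FormalEdgeExpansion αT′ [ o ]   = [ ↝⇒FormalExp₁α αT′ o ]
↝⁺⇒FormalEdgeExpansion αT′ (o ∷ r) =
  ↝⁺⇒FormalEdgeExpansion (↝-IsAlphaTree αT′ o) r ∷ʳ ↝⇒FormalExp₁α αT′ o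

FormalExp₁⇒↝ : ∀ {α T T′} → IsAlphaTree α T → IsAlphaTree α T′ → FormalExp₁ (f T) (f T′) → T′ ↝ T
FormalExp₁⇒↝ {T = T} {T′} αT αT′ step with liftFormalExp₁ T αT′ step
... | T″ , o , fT″≡fT = subst (T′ ↝_) (f-injective (↝-IsAlphaTree αT′ o) αT fT″≡fT) o

FormalEdgeExpansion⇒↝⁺ : ∀ {α X X′} → FormalEdgeExpansion α X X′ →
                          ∀ {T T′} → IsAlphaTree α T → IsAlphaTree α T′ → f T ≡ X → f T′ ≡ X′ → T′ ↝⁺ T
FormalEdgeExpansion⇒↝⁺ [ _ , _ , step ] αT αT′ refl refl = [ FormalExp₁⇒↝ αT αT′ step ]
FormalEdgeExpansion⇒↝⁺ ((_ , (T₁ , αT₁ , refl) , step) ∷ r) αT αT′ refl fT′≡ =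
  FormalEdgeExpansion⇒↝⁺ r αT₁ αT′ refl fT′≡ ∷ʳ FormalExp₁⇒↝ αT αT₁ step

lemma2p7 : (α : List Lbl) (T T' : Tree) →
    IsAlphaTree α T → IsAlphaTree α T' →
    (EdgeExpansion T' T ⇔ FormalEdgeExpansion α (f T) (f T'))
lemma2p7 α T T' αT αT′ = mk⇔
  (λ expansion → ↝⁺⇒FormalEdgeExpansion αT′ (EdgeExpansion⇒↝⁺ expansion))
  (λ formal → ↝⁺⇒EdgeExpansion (FormalEdgeExpansion⇒↝⁺ formal αT αT′ refl refl))
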